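{- Let $D\subseteq\mathbb{Z}^2$ be a diagram with at most three nonempty rows and no column containing three cells. Then $D$ is equivalent to a toric cylindric skew shape: there exist $p\ge1$, a toric cylindric skew shape $E\subseteq\mathcal{C}_{3,p}$, and injections $\alpha$ from the set of row indices of $D$ to $\mathbb{Z}/3\mathbb{Z}$ and $\beta$ from the set of column indices of $D$ to $\mathbb{Z}/p\mathbb{Z}$ such that $(i,j)\mapsto(\alpha(i),\beta(j))$ maps $D$ bijectively onto the image of $E$ in $\mathbb{Z}/3\mathbb{Z}\times\mathbb{Z}/p\mathbb{Z}$.
   Context: $\mathcal{C}_{a,b}=\mathbb{Z}^2/\mathbb{Z}(a,b)$, with first coordinate the row index (increasing downward) and second the column index (increasing rightward). A closed lattice path moving northwest to southeast in $\mathcal{C}_{a,b}$ is a circular sequence $(p_1,\dots,p_{a+b})$ indexed by $\mathbb{Z}/(a+b)\mathbb{Z}$ with $p_{i+1}-p_i\in\{(1,0),(0,1)\}$, viewed as a union of unit segments. A cylindric skew shape is the set of unit cells of $\mathcal{C}_{a,b}$ between two such paths that do not cross (they may meet). It is toric if the quotient map $\mathcal{C}_{a,b}\to\mathbb{Z}/a\mathbb{Z}\times\mathbb{Z}/b\mathbb{Z}$ is injective on it. Rows of $D\subseteq\mathbb{Z}^2$ are sets of cells with equal first coordinate, columns with equal second coordinate. -}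

module Defs where

open import Data.Nat using (ℕ)
open import Data.Integer using (ℤ; +_; _+_; _-_; _*_; _≤_; _<_)
open import Data.Integer.Divisibility using (_∣_)
open import Data.Product using (Σ; ∃; _×_; _,_; proj₁; proj₂)
open import Data.Sum using (_⊎_)
open import Data.List using (List)
open import Data.List.Membership.Propositional using (_∈_)
open import Relation.Binary.PropositionalEquality using (_≡_; _≢_)
open import Relation.Nullary using (¬_)

-- A cell of ℤ² : (row index , column index); rows increase downward,
-- columns increase rightward.  Lattice points use the same coordinates.
-- Cell (i , j) is the unit square with corners (i , j) and (i+1 , j+1).
Cell : Set
Cell = ℤ × ℤ

-- congruence modulo n on ℤ  (ℤ/nℤ is represented by ℤ up to this relation)
_≡_[mod_] : ℤ → ℤ → ℕ → Set
a ≡ b [mod n ] = (+ n) ∣ (a - b)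

Diagram : Set
Diagram = List Cell

IsRow : Diagram → ℤ → Set
IsRow D i = ∃ λ j → (i , j) ∈ D

IsCol : Diagram → ℤ → Set
IsCol D j = ∃ λ i → (i , j) ∈ D

AtMostThreeRows : Diagram → Set
AtMostThreeRows D =
  Σ ℤ λ r₁ → Σ ℤ λ r₂ → Σ ℤ λ r₃ →
    ∀ i → IsRow D i → (i ≡ r₁) ⊎ (i ≡ r₂) ⊎ (i ≡ r₃)

NoColumnWithThree : Diagram → Set
NoColumnWithThree D =
  ∀ i₁ i₂ i₃ j → (i₁ , j) ∈ D → (i₂ , j) ∈ D → (i₃ , j) ∈ D →
    ¬ (i₁ ≢ i₂ × i₁ ≢ i₃ × i₂ ≢ i₃)

-- Closed lattice paths in C_{a,b} = ℤ² / ℤ(a,b), NW to SE.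
-- A closed path (p_1,…,p_{a+b}) indexed by ℤ/(a+b) is represented by its
-- lift to ℤ²: a bi-infinite sequence P : ℤ → ℤ² with unit steps (1,0)
-- or (0,1) and P (k + (a+b)) = P k + (a , b)  (the lift of a closed path
-- of length a+b necessarily has total displacement exactly (a,b)).

Step : Cell → Cell → Set
Step (i , j) (i' , j') = (i' ≡ i + + 1 × j' ≡ j) ⊎ (i' ≡ i × j' ≡ j + + 1)

record ClosedPath (a b : ℕ) : Set where
  field
    pt       : ℤ → Cell
    step     : ∀ k → Step (pt k) (pt (k + + 1))
    periodic : ∀ k → pt (k + (+ a + + b)) ≡ (proj₁ (pt k) + + a , proj₂ (pt k) + + b)
open ClosedPath public

VStep : ∀ {a b} → ClosedPath a b → ℤ → ℤ → Set
VStep P i x = ∃ λ k → pt P k ≡ (i , x) × pt P (k + + 1) ≡ (i + + 1 , x)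

RightOf : ∀ {a b} → ClosedPath a b → Cell → Set
RightOf P (i , j) = ∃ λ x → VStep P i x × x ≤ j

LeftOf : ∀ {a b} → ClosedPath a b → Cell → Set
LeftOf P (i , j) = ∃ λ y → VStep P i y × j < y

NonCrossing : ∀ {a b} → ClosedPath a b → ClosedPath a b → Set
NonCrossing P Q = ∀ i x y → VStep P i x → VStep Q i y → x ≤ y

-- Its cells are given by their representatives in ℤ²
-- (the set of representatives is invariant under translation by (a,b)).
record CylSkew (a b : ℕ) : Set where
  field
    left  : ClosedPath a b
    right : ClosedPath a b
    nonCrossing : NonCrossing left right
open CylSkew public

InShape : ∀ {a b} → CylSkew a b → Cell → Set
InShape E c = RightOf (left E) c × LeftOf (right E) c

-- Toric: the quotient map C_{a,b} → ℤ/a × ℤ/b is injective on E.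
Toric : ∀ {a b} → CylSkew a b → Set
Toric {a} {b} E = ∀ i j i' j' → InShape E (i , j) → InShape E (i' , j') →
  i ≡ i' [mod a ] → j ≡ j' [mod b ] →
  ∃ λ (k : ℤ) → i' ≡ i + k * + a × j' ≡ j + k * + b

InImage : ∀ {a b} → CylSkew a b → ℤ → ℤ → Set
InImage {a} {b} E r c = ∃ λ i → ∃ λ j → InShape E (i , j) × i ≡ r [mod a ] × j ≡ c [mod b ]

-- D is equivalent to the toric cylindric skew shape E ⊆ C_{3,p}
-- via α : rows(D) ↪ ℤ/3 and β : cols(D) ↪ ℤ/p  (α, β given as maps
-- ℤ → ℤ read modulo 3, resp. p; only their values on rows/columns matter).

EquivVia : (D : Diagram) (p : ℕ) (E : CylSkew 3 p) (α β : ℤ → ℤ) → Set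
EquivVia D p E α β =
  (∀ i i' → IsRow D i → IsRow D i' → α i ≡ α i' [mod 3 ] → i ≡ i')
  × (∀ j j' → IsCol D j → IsCol D j' → β j ≡ β j' [mod p ] → j ≡ j')
  × (∀ i j → (i , j) ∈ D → InImage E (α i) (β j))
  × (∀ i j i' j' → (i , j) ∈ D → (i' , j') ∈ D →
       α i ≡ α i' [mod 3 ] → β j ≡ β j' [mod p ] → (i , j) ≡ (i' , j'))
  × (∀ r c → InImage E r c →
       ∃ λ i → ∃ λ j → (i , j) ∈ D × α i ≡ r [mod 3 ] × β j ≡ c [mod p ])

module Submission where

-- Lemma 7.18.  Number the nonempty rows of D as 0, 1, 2.  Every column
-- meets one of the row sets {2,0}, {0}, {0,1}, {1}, {1,2}, {2}, numbered
-- cyclically 0 … 5 (its type).  Listing the distinct columns of D by type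
-- gives consecutive blocks of positions 0 … p-1, and row s then occupies
-- blocks 2s, 2s+1, 2s+2 (mod 6): a cyclic interval of at most p positions.
-- So (i , j) ↦ (row number of i , position of j) maps D onto the image in
-- ℤ/3 × ℤ/p of the cylindric shape whose row s is that interval.

open import Defs
open import Data.Nat using (ℕ; _≤_)
open import Data.Integer using (ℤ)
open import Data.Product using (Σ; _×_)

import Data.Nat as N
open N using (zero; suc; z≤n; s≤s)
import Data.Nat.Properties as NP
import Data.Nat.Divisibility as ND
open import Data.Integer using (+_; _+_; _-_; _*_; ∣_∣; _%_; _/_)
import Data.Integer as Z
import Data.Integer.Properties as ZP
import Data.Integer.DivMod as ZD
import Data.Integer.Divisibility.Signed as ZS
open import Data.Integer.Divisibility using (_∣_)
open import Data.Integer.Tactic.RingSolver using (solve-∀)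
open import Data.Product using (∃; _,_; proj₁; proj₂)
open import Data.Sum using (_⊎_; inj₁; inj₂)
open import Data.Empty using (⊥-elim)
open import Relation.Binary.PropositionalEquality
open import Relation.Binary.Definitions using (tri<; tri≈; tri>)
open import Relation.Nullary using (¬_; Dec; yes; no)
open import Data.List using (List; []; _∷_; length; map; filter; deduplicate)
open import Data.List.Membership.Propositional using (_∈_; find; lose)
import Data.List.Membership.Propositional.Properties as ∈P
open import Data.List.Relation.Unary.Any using (Any; here; there; any?)
open import Data.List.Relation.Unary.Unique.DecPropositional.Properties Z._≟_ using (deduplicate-!)
open import Relation.Nullary.Decidable using (map′; _×-dec_)
import Data.List.Relation.Unary.All as All
open import Data.List.Relation.Unary.Unique.Propositional using (Unique; _∷_)

∣-multiple : ∀ n {x} k → x ≡ k * + n → + n ∣ x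
∣-multiple n k refl = ZS.∣⇒∣ᵤ (ZS.divides k refl)

mod-refl : ∀ n a → a ≡ a [mod n ]
mod-refl n a = ∣-multiple n (+ 0) (trans (ZP.+-inverseʳ a) (sym (ZP.*-zeroˡ (+ n))))

mod-sym : ∀ {n} a b → a ≡ b [mod n ] → b ≡ a [mod n ]
mod-sym {n} a b = subst (n ND.∣_) (ZP.∣i-j∣≡∣j-i∣ a b)

mod-trans : ∀ {n} a b c → a ≡ b [mod n ] → b ≡ c [mod n ] → a ≡ c [mod n ]
mod-trans {n} a b c a≡b b≡c =
  ZS.∣⇒∣ᵤ (subst (ZS._∣_ (+ n)) (telescope a b c)
    (ZS.∣m∣n⇒∣m+n (ZS.∣ᵤ⇒∣ {+ n} {a - b} a≡b) (ZS.∣ᵤ⇒∣ {+ n} {b - c} b≡c)))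
  where
  telescope : ∀ a b c → (a - b) + (b - c) ≡ a - c
  telescope = solve-∀

mod-remainder : ∀ n {x} r q → x ≡ r + q * + n → x ≡ r [mod n ]
mod-remainder n {x} r q refl = ∣-multiple n q (difference r q (+ n))
  where
  difference : ∀ r q n → (r + q * n) - r ≡ q * n
  difference = solve-∀

multiple-below : ∀ {n d} → d N.< n → n ND.∣ d → d ≡ 0
multiple-below {d = zero} _ _ = refl
multiple-below {d = suc d} d<n n∣d = ⊥-elim (ND.>⇒∤ d<n n∣d)

window-ordered : ∀ {n A u v} → A N.≤ u → u N.≤ v → v N.< A N.+ n →
                 (+ u) ≡ (+ v) [mod n ] → u ≡ v
window-ordered {n} {A} {u} {v} A≤u u≤v v<A+n u≡v =
  NP.≤-antisym u≤v (NP.m∸n≡0⇒m≤n (multiple-below gap<n (subst (n ND.∣_) gap u≡v)))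
  where
  gap : ∣ + u - + v ∣ ≡ v N.∸ u
  gap = trans (cong ∣_∣ (ZP.m-n≡m⊖n u v)) (ZP.∣⊖∣-≤ u≤v)
  gap<n : v N.∸ u N.< n
  gap<n = subst (v N.∸ u N.<_) (NP.m+n∸m≡n u n)
            (NP.∸-monoˡ-< (NP.<-≤-trans v<A+n (NP.+-monoˡ-≤ n A≤u)) u≤v)

window-unique : ∀ {n A u v} → A N.≤ u → u N.< A N.+ n → A N.≤ v → v N.< A N.+ n →
                (+ u) ≡ (+ v) [mod n ] → u ≡ v
window-unique {u = u} {v} A≤u u<A+n A≤v v<A+n u≡v with NP.≤-total u v
... | inj₁ u≤v = window-ordered A≤u u≤v v<A+n u≡v
... | inj₂ v≤u = sym (window-ordered A≤v v≤u u<A+n (mod-sym (+ u) (+ v) u≡v))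

+-cancelˡ-ℤ : ∀ a {b c} → a + b ≡ a + c → b ≡ c
+-cancelˡ-ℤ a {b} {c} eq = begin
  b             ≡⟨ undo a b ⟩
  (a + b) - a   ≡⟨ cong (_- a) eq ⟩
  (a + c) - a   ≡⟨ undo a c ⟨
  c             ∎
  where
  open ≡-Reasoning
  undo : ∀ a b → b ≡ (a + b) - a
  undo = solve-∀

divmod-unique : ∀ n {r r' q q'} → r N.< suc n → r' N.< suc n →
                + r + q * + suc n ≡ + r' + q' * + suc n → r ≡ r' × q ≡ q'
divmod-unique n {r} {r'} {q} {q'} r<n r'<n eq = r≡r' , q≡q'
  where
  r≡r' : r ≡ r'
  r≡r' = window-unique z≤n r<n z≤n r'<n
           (mod-trans (+ r) (+ r + q * + suc n) (+ r')
                      (mod-sym (+ r + q * + suc n) (+ r) (mod-remainder (suc n) (+ r) q refl))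
                      (mod-remainder (suc n) (+ r') q' eq))
  q≡q' : q ≡ q'
  q≡q' = ZP.*-cancelʳ-≡ q q' (+ suc n)
           (+-cancelˡ-ℤ (+ r) (subst (λ t → + r + q * + suc n ≡ + t + q' * + suc n) (sym r≡r') eq))

divmod : ∀ n i → i ≡ + (i % + suc n) + (i / + suc n) * + suc n
divmod n i = ZD.a≡a%n+[a/n]*n i (+ suc n)

split-window : ∀ {j c : ℤ} {L U : ℕ} → + L + c Z.≤ j → j Z.< + U + c →
               ∃ λ w → j ≡ + w + c × L N.≤ w × w N.< U
split-window {j} {c} {L} {U} L+c≤j j<U+c =
  ∣ j - c ∣ , j≡ , ZP.drop‿+≤+ (subst (+ L Z.≤_) (sym w≡) L≤d) , ZP.drop‿+<+ (subst (Z._< + U) (sym w≡) d<U)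
  where
  shift : ∀ x c → (x + c) - c ≡ x
  shift = solve-∀
  L≤d : + L Z.≤ j - c
  L≤d = subst (Z._≤ j - c) (shift (+ L) c) (ZP.+-monoˡ-≤ (Z.- c) L+c≤j)
  d<U : j - c Z.< + U
  d<U = subst (j - c Z.<_) (shift (+ U) c) (ZP.+-monoˡ-< (Z.- c) j<U+c)
  w≡ : + ∣ j - c ∣ ≡ j - c
  w≡ = ZP.0≤i⇒+∣i∣≡i (ZP.≤-trans (Z.+≤+ z≤n) L≤d)
  j≡ : j ≡ + ∣ j - c ∣ + c
  j≡ = trans (restore j c) (cong (_+ c) (sym w≡))
    where
    restore : ∀ j c → j ≡ (j - c) + c
    restore = solve-∀

-- c 0, c 1, c 2 are column lines on which a path crossing rows 0, 1, 2 can
-- go down: they weakly increase, and the next period starts at c 0 + p.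
Staircase : ℕ → (ℕ → ℕ) → Set
Staircase p c = c 0 N.≤ c 1 × c 1 N.≤ c 2 × c 2 N.≤ c 0 N.+ p

below : ℕ → ℕ → ℕ
below t m with t N.<? m
... | yes _ = 1
... | no _ = 0

below-yes : ∀ {t m} → t N.< m → below t m ≡ 1
below-yes {t} {m} t<m with t N.<? m
... | yes _ = refl
... | no t≮m = ⊥-elim (t≮m t<m)

below-no : ∀ {t m} → m N.≤ t → below t m ≡ 0
below-no {t} {m} m≤t with t N.<? m
... | yes t<m = ⊥-elim (NP.<⇒≱ t<m m≤t)
... | no _ = refl

below-suc : ∀ {t m} → m ≢ t → below t (suc m) ≡ below t m
below-suc {t} {m} m≢t with NP.<-cmp t m
... | tri< t<m _ _ = trans (below-yes (NP.m<n⇒m<1+n t<m)) (sym (below-yes t<m))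
... | tri≈ _ t≡m _ = ⊥-elim (m≢t (sym t≡m))
... | tri> _ _ m<t = trans (below-no m<t) (sym (below-no (NP.<⇒≤ m<t)))

sum₃ : ∀ {x y z x' y' z'} → x ≡ x' → y ≡ y' → z ≡ z' → x N.+ y N.+ z ≡ x' N.+ y' N.+ z'
sum₃ refl refl refl = refl

-- The path whose vertical step in row i = r + 3q (r < 3) lies on the column
-- line  c r + q p.  Its lift is indexed by ℤ; one period consists of the
-- 3 + p steps numbered 0 … 2 + p, of which the vertical ones are the
-- steps  vertical 0 < vertical 1 < vertical 2.
module StaircasePath (p : ℕ) (c : ℕ → ℕ) (staircase : Staircase p c) where

  c₀≤c : ∀ r → r N.< 3 → c 0 N.≤ c r
  c₀≤c 0 _ = NP.≤-refl
  c₀≤c 1 _ = proj₁ staircase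
  c₀≤c 2 _ = NP.≤-trans (proj₁ staircase) (proj₁ (proj₂ staircase))
  c₀≤c (suc (suc (suc _))) (s≤s (s≤s (s≤s ())))

  vertical : ℕ → ℕ
  vertical r = r N.+ (c r N.∸ c 0)

  v₀<v₁ : vertical 0 N.< vertical 1
  v₀<v₁ = s≤s (NP.∸-monoˡ-≤ (c 0) (proj₁ staircase))

  v₁<v₂ : vertical 1 N.< vertical 2
  v₁<v₂ = s≤s (s≤s (NP.∸-monoˡ-≤ (c 0) (proj₁ (proj₂ staircase))))

  v₂<period : vertical 2 N.< 3 N.+ p
  v₂<period = s≤s (s≤s (s≤s (NP.m≤n+o⇒m∸n≤o (c 2) (c 0) (proj₂ (proj₂ staircase)))))

  vertical<period : ∀ r → r N.< 3 → vertical r N.< 3 N.+ p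
  vertical<period 0 _ = NP.<-trans v₀<v₁ (NP.<-trans v₁<v₂ v₂<period)
  vertical<period 1 _ = NP.<-trans v₁<v₂ v₂<period
  vertical<period 2 _ = v₂<period
  vertical<period (suc (suc (suc _))) (s≤s (s≤s (s≤s ())))

  vertical-column : ∀ r → r N.< 3 → (+ c 0 + + vertical r) - + r ≡ + c r
  vertical-column r r<3 = begin
    (+ c 0 + + vertical r) - + r             ≡⟨ cong (λ t → (+ c 0 + t) - + r) (ZP.pos-+ r (c r N.∸ c 0)) ⟩
    (+ c 0 + (+ r + + (c r N.∸ c 0))) - + r  ≡⟨ cancel (+ c 0) (+ r) (+ (c r N.∸ c 0)) ⟩
    + (c 0 N.+ (c r N.∸ c 0))                ≡⟨ cong +_ (NP.m+[n∸m]≡n (c₀≤c r r<3)) ⟩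
    + c r                                    ∎
    where
    open ≡-Reasoning
    cancel : ∀ a r d → (a + (r + d)) - r ≡ a + d
    cancel = solve-∀

  -- Number of vertical steps among the steps 0 … m - 1 of a period.
  rowsBefore : ℕ → ℕ
  rowsBefore m = below (vertical 0) m N.+ below (vertical 1) m N.+ below (vertical 2) m

  rowsBefore₀ : ∀ {m} → m N.≤ vertical 0 → rowsBefore m ≡ 0
  rowsBefore₀ m≤v₀ = sum₃ (below-no m≤v₀) (below-no m≤v₁) (below-no (NP.≤-trans m≤v₁ (NP.<⇒≤ v₁<v₂)))
    where m≤v₁ = NP.≤-trans m≤v₀ (NP.<⇒≤ v₀<v₁)

  rowsBefore₁ : ∀ {m} → vertical 0 N.< m → m N.≤ vertical 1 → rowsBefore m ≡ 1
  rowsBefore₁ v₀<m m≤v₁ = sum₃ (below-yes v₀<m) (below-no m≤v₁) (below-no (NP.≤-trans m≤v₁ (NP.<⇒≤ v₁<v₂)))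

  rowsBefore₂ : ∀ {m} → vertical 1 N.< m → m N.≤ vertical 2 → rowsBefore m ≡ 2
  rowsBefore₂ v₁<m m≤v₂ = sum₃ (below-yes (NP.<-trans v₀<v₁ v₁<m)) (below-yes v₁<m) (below-no m≤v₂)

  rowsBefore₃ : ∀ {m} → vertical 2 N.< m → rowsBefore m ≡ 3
  rowsBefore₃ v₂<m = sum₃ (below-yes (NP.<-trans v₀<v₁ (NP.<-trans v₁<v₂ v₂<m)))
                          (below-yes (NP.<-trans v₁<v₂ v₂<m)) (below-yes v₂<m)

  rowsBefore-vertical : ∀ r → r N.< 3 → rowsBefore (vertical r) ≡ r × rowsBefore (suc (vertical r)) ≡ suc r
  rowsBefore-vertical 0 _ = rowsBefore₀ NP.≤-refl , rowsBefore₁ NP.≤-refl v₀<v₁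
  rowsBefore-vertical 1 _ = rowsBefore₁ v₀<v₁ NP.≤-refl , rowsBefore₂ NP.≤-refl v₁<v₂
  rowsBefore-vertical 2 _ = rowsBefore₂ v₁<v₂ NP.≤-refl , rowsBefore₃ NP.≤-refl
  rowsBefore-vertical (suc (suc (suc _))) (s≤s (s≤s (s≤s ())))

  IsVertical : ℕ → Set
  IsVertical m = rowsBefore m N.< 3 × m ≡ vertical (rowsBefore m)

  vertical-step : ∀ r → r N.< 3 →
    rowsBefore (suc (vertical r)) ≡ suc (rowsBefore (vertical r)) × IsVertical (vertical r)
  vertical-step r r<3 with rowsBefore-vertical r r<3
  ... | at , after = trans after (cong suc (sym at)) , subst (λ t → t N.< 3 × vertical r ≡ vertical t) (sym at) (r<3 , refl)

  rowsBefore-step : ∀ m → rowsBefore (suc m) ≡ rowsBefore m ⊎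
                          (rowsBefore (suc m) ≡ suc (rowsBefore m) × IsVertical m)
  rowsBefore-step m with m N.≟ vertical 0 | m N.≟ vertical 1 | m N.≟ vertical 2
  ... | yes refl | _ | _ = inj₂ (vertical-step 0 (s≤s z≤n))
  ... | no _ | yes refl | _ = inj₂ (vertical-step 1 (s≤s (s≤s z≤n)))
  ... | no _ | no _ | yes refl = inj₂ (vertical-step 2 (s≤s (s≤s (s≤s z≤n))))
  ... | no m≢v₀ | no m≢v₁ | no m≢v₂ = inj₁ (sum₃ (below-suc m≢v₀) (below-suc m≢v₁) (below-suc m≢v₂))

  -- The lift:  point k = (row k , column k), with k = m + q (3 + p).
  period : ℤ
  period = + (3 N.+ p)

  row : ℤ → ℤ
  row k = + rowsBefore (k % period) + (k / period) * + 3

  column : ℤ → ℤ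
  column k = (+ c 0 + k) - row k

  row-at : ∀ k m q → m N.< 3 N.+ p → k ≡ + m + q * period → row k ≡ + rowsBefore m + q * + 3
  row-at k m q m<period k≡ = cong₂ (λ r q → + rowsBefore r + q * + 3) (proj₁ unique) (proj₂ unique)
    where unique = divmod-unique (2 N.+ p) {q = k / period} {q' = q} (ZD.n%d<d k period) m<period (trans (sym (divmod (2 N.+ p) k)) k≡)

  row-suc : ∀ k m q → m N.< 3 N.+ p → k ≡ + m + q * period →
            row (k + + 1) ≡ + rowsBefore (suc m) + q * + 3
  row-suc k m q m<period k≡ with NP.m≤n⇒m<n∨m≡n (N.s≤s⁻¹ m<period)
  ... | inj₁ m<last = row-at (k + + 1) (suc m) q (s≤s m<last) (trans (cong (_+ + 1) k≡) (next (+ m) q period))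
    where
    next : ∀ m q K → (m + q * K) + + 1 ≡ (+ 1 + m) + q * K
    next = solve-∀
  ... | inj₂ refl = begin
    row (k + + 1)                        ≡⟨ row-at (k + + 1) 0 (q + + 1) (s≤s z≤n) (trans (cong (_+ + 1) k≡) (wrap (+ m) q)) ⟩
    + rowsBefore 0 + (q + + 1) * + 3     ≡⟨ cong (λ t → + t + (q + + 1) * + 3) (rowsBefore₀ z≤n) ⟩
    + 0 + (q + + 1) * + 3                ≡⟨ next-period q ⟩
    + 3 + q * + 3                        ≡⟨ cong (λ t → + t + q * + 3) (sym (rowsBefore₃ v₂<period)) ⟩
    + rowsBefore (suc m) + q * + 3       ∎
    where
    open ≡-Reasoning
    wrap : ∀ m q → (m + q * (+ 1 + m)) + + 1 ≡ + 0 + (q + + 1) * (+ 1 + m)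
    wrap = solve-∀
    next-period : ∀ q → + 0 + (q + + 1) * + 3 ≡ + 3 + q * + 3
    next-period = solve-∀

  column-at : ∀ k m q → m N.< 3 N.+ p → k ≡ + m + q * period →
              column k ≡ ((+ c 0 + + m) - + rowsBefore m) + q * + p
  column-at k m q m<period k≡ = begin
    (+ c 0 + k) - row k                                          ≡⟨ cong₂ (λ k r → (+ c 0 + k) - r) k≡ (row-at k m q m<period k≡) ⟩
    (+ c 0 + (+ m + q * period)) - (+ rowsBefore m + q * + 3)     ≡⟨ regroup (+ c 0) (+ m) (+ rowsBefore m) q (+ p) ⟩
    ((+ c 0 + + m) - + rowsBefore m) + q * + p                   ∎
    where
    open ≡-Reasoning
    regroup : ∀ a m r q p → (a + (m + q * (+ 3 + p))) - (r + q * + 3) ≡ ((a + m) - r) + q * p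
    regroup = solve-∀

  index-decomp : ∀ k → k ≡ + (k % period) + (k / period) * period
  index-decomp = divmod (2 N.+ p)

  index-rem<period : ∀ k → k % period N.< 3 N.+ p
  index-rem<period k = ZD.n%d<d k period

  row-step : ∀ k → row (k + + 1) ≡ row k ⊎ (row (k + + 1) ≡ row k + + 1 × IsVertical (k % period))
  row-step k with rowsBefore-step (k % period)
  ... | inj₁ same = inj₁ (trans next (cong (λ t → + t + (k / period) * + 3) same))
    where next = row-suc k (k % period) (k / period) (index-rem<period k) (index-decomp k)
  ... | inj₂ (up , vert) = inj₂ (trans next (trans (cong (λ t → + t + (k / period) * + 3) up)
                                             (one-more (+ rowsBefore (k % period)) ((k / period) * + 3))) , vert)
    where
    next = row-suc k (k % period) (k / period) (index-rem<period k) (index-decomp k)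
    one-more : ∀ r x → + 1 + r + x ≡ (r + x) + + 1
    one-more = solve-∀

  column-keep : ∀ k → row (k + + 1) ≡ row k + + 1 → column (k + + 1) ≡ column k
  column-keep k eq = trans (cong (λ r → (+ c 0 + (k + + 1)) - r) eq) (same (+ c 0) k (row k))
    where
    same : ∀ a k r → (a + (k + + 1)) - (r + + 1) ≡ (a + k) - r
    same = solve-∀

  column-next : ∀ k → row (k + + 1) ≡ row k → column (k + + 1) ≡ column k + + 1
  column-next k eq = trans (cong (λ r → (+ c 0 + (k + + 1)) - r) eq) (next (+ c 0) k (row k))
    where
    next : ∀ a k r → (a + (k + + 1)) - r ≡ ((a + k) - r) + + 1
    next = solve-∀

  path-step : ∀ k → Step (row k , column k) (row (k + + 1) , column (k + + 1))
  path-step k with row-step k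
  ... | inj₁ same = inj₂ (same , column-next k same)
  ... | inj₂ (down , _) = inj₁ (down , column-keep k down)

  row-periodic : ∀ k → row (k + period) ≡ row k + + 3
  row-periodic k = trans (row-at (k + period) (k % period) (k / period + + 1) (index-rem<period k) (trans (cong (_+ period) (index-decomp k)) (shift (+ (k % period)) (k / period) period)))
                         (regroup (+ rowsBefore (k % period)) (k / period))
    where
    shift : ∀ m q K → (m + q * K) + K ≡ m + (q + + 1) * K
    shift = solve-∀
    regroup : ∀ r q → r + (q + + 1) * + 3 ≡ (r + q * + 3) + + 3
    regroup = solve-∀

  column-periodic : ∀ k → column (k + period) ≡ column k + + p
  column-periodic k = trans (cong (λ r → (+ c 0 + (k + period)) - r) (row-periodic k)) (regroup (+ c 0) k (row k) (+ p))
    where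
    regroup : ∀ a k r p → (a + (k + (+ 3 + p))) - (r + + 3) ≡ ((a + k) - r) + p
    regroup = solve-∀

  path : ClosedPath 3 p
  path = record
    { pt       = λ k → row k , column k
    ; step     = path-step
    ; periodic = λ k → cong₂ _,_ (row-periodic k) (column-periodic k)
    }

  vstep-at : ∀ r q → r N.< 3 → VStep path (+ r + q * + 3) (+ c r + q * + p)
  vstep-at r q r<3 = k , cong₂ _,_ row-k column-k , cong₂ _,_ row-k' (trans (column-keep k row-k'') column-k)
    where
    k = + vertical r + q * period
    v<period = vertical<period r r<3
    at = rowsBefore-vertical r r<3
    row-k : row k ≡ + r + q * + 3
    row-k = trans (row-at k (vertical r) q v<period refl) (cong (λ t → + t + q * + 3) (proj₁ at))
    row-k' : row (k + + 1) ≡ (+ r + q * + 3) + + 1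
    row-k' = trans (row-suc k (vertical r) q v<period refl)
               (trans (cong (λ t → + t + q * + 3) (proj₂ at)) (one-more (+ r) (q * + 3)))
      where
      one-more : ∀ r x → + 1 + r + x ≡ (r + x) + + 1
      one-more = solve-∀
    row-k'' : row (k + + 1) ≡ row k + + 1
    row-k'' = trans row-k' (cong (_+ + 1) (sym row-k))
    column-k : column k ≡ + c r + q * + p
    column-k = trans (column-at k (vertical r) q v<period refl)
                 (trans (cong (λ t → ((+ c 0 + + vertical r) - + t) + q * + p) (proj₁ at))
                        (cong (_+ q * + p) (vertical-column r r<3)))

  vstep-unique : ∀ {i x} → VStep path i x →
                 ∃ λ r → ∃ λ q → r N.< 3 × i ≡ + r + q * + 3 × x ≡ + c r + q * + p
  vstep-unique {i} {x} (k , at-k , at-k') with row-step k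
  ... | inj₁ same = ⊥-elim (i+1≢i (trans (sym (cong proj₁ at-k')) (trans same (cong proj₁ at-k))))
    where
    i+1≢i : i + + 1 ≢ i
    i+1≢i eq = ZP.i≢suc[i] (sym (trans (ZP.+-comm (+ 1) i) eq))
  ... | inj₂ (_ , r<3 , m≡) = rowsBefore m , k / period , r<3 , sym (cong proj₁ at-k) , x≡
    where
    m = k % period
    x≡ : x ≡ + c (rowsBefore m) + (k / period) * + p
    x≡ = trans (sym (cong proj₂ at-k))
           (trans (column-at k m (k / period) (index-rem<period k) (index-decomp k))
             (cong (_+ (k / period) * + p)
               (trans (cong (λ t → (+ c 0 + + t) - + rowsBefore m) m≡) (vertical-column (rowsBefore m) r<3))))

-- The cylindric shape whose row r + 3q (r < 3) consists of the cells
-- with columns  w + q p,  lower r ≤ w < upper r.  It lies between the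
-- staircase paths of  lower  and  upper, and it is toric because no row is
-- longer than p.
module BandShape (p : ℕ) (lower upper : ℕ → ℕ)
       (lower-staircase : Staircase p lower) (upper-staircase : Staircase p upper)
       (lower≤upper : ∀ r → r N.< 3 → lower r N.≤ upper r)
       (upper≤lower+p : ∀ r → r N.< 3 → upper r N.≤ lower r N.+ p) where

  private
    module L = StaircasePath p lower lower-staircase
    module U = StaircasePath p upper upper-staircase

  InBand : ℕ → ℕ → Set
  InBand r w = lower r N.≤ w × w N.< upper r

  crossings : ∀ {i x y} → VStep L.path i x → VStep U.path i y →
    ∃ λ r → ∃ λ q → r N.< 3 × i ≡ + r + q * + 3 × x ≡ + lower r + q * + p × y ≡ + upper r + q * + p
  crossings {i} {x} {y} vx vy with L.vstep-unique vx | U.vstep-unique vy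
  ... | r , q , r<3 , i≡ , x≡ | r' , q' , r'<3 , i≡' , y≡ = r , q , r<3 , i≡ , x≡ , y≡'
    where
    same : r ≡ r' × q ≡ q'
    same = divmod-unique 2 r<3 r'<3 (trans (sym i≡) i≡')
    y≡' : y ≡ + upper r + q * + p
    y≡' = trans y≡ (cong₂ (λ r q → + upper r + q * + p) (sym (proj₁ same)) (sym (proj₂ same)))

  non-crossing : NonCrossing L.path U.path
  non-crossing i x y vx vy = from-crossings (crossings vx vy)
    where
    from-crossings : (∃ λ r → ∃ λ q → r N.< 3 × i ≡ + r + q * + 3 ×
                        x ≡ + lower r + q * + p × y ≡ + upper r + q * + p) → x Z.≤ y
    from-crossings (r , q , r<3 , _ , refl , refl) = ZP.+-monoˡ-≤ (q * + p) (Z.+≤+ (lower≤upper r r<3))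

  shape : CylSkew 3 p
  shape = record { left = L.path ; right = U.path ; nonCrossing = non-crossing }

  in-shape : ∀ {r w} q → r N.< 3 → InBand r w → InShape shape (+ r + q * + 3 , + w + q * + p)
  in-shape {r} {w} q r<3 (l , u) = right-of-lower , left-of-upper
    where
    right-of-lower : RightOf L.path (+ r + q * + 3 , + w + q * + p)
    right-of-lower = + lower r + q * + p , L.vstep-at r q r<3 , ZP.+-monoˡ-≤ (q * + p) (Z.+≤+ l)
    left-of-upper : LeftOf U.path (+ r + q * + 3 , + w + q * + p)
    left-of-upper = + upper r + q * + p , U.vstep-at r q r<3 , ZP.+-monoˡ-< (q * + p) (Z.+<+ u)

  ShapeCell : ℤ → ℤ → Set
  ShapeCell i j = ∃ λ r → ∃ λ q → ∃ λ w → r N.< 3 × i ≡ + r + q * + 3 × j ≡ + w + q * + p × InBand r w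

  shape-cell : ∀ {i j} → InShape shape (i , j) → ShapeCell i j
  shape-cell {i} {j} ((x , vx , x≤j) , (y , vy , j<y)) = from-crossings (crossings vx vy)
    where
    from-crossings : (∃ λ r → ∃ λ q → r N.< 3 × i ≡ + r + q * + 3 ×
                        x ≡ + lower r + q * + p × y ≡ + upper r + q * + p) → ShapeCell i j
    from-crossings (r , q , r<3 , i≡ , refl , refl) =
      let (w , j≡ , l , u) = split-window {j} {q * + p} {lower r} {upper r} x≤j j<y
      in r , q , w , r<3 , i≡ , j≡ , l , u

  -- Two cells of the shape with congruent coordinates lie in the same row
  -- residue r and, since no row is longer than p, at the same offset w;
  -- so they differ by a multiple of (3 , p).
  toric : Toric shape
  toric i j i' j' s s' i≡i' j≡j' = translate (shape-cell s) (shape-cell s')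
    where
    translate : ShapeCell i j → ShapeCell i' j' → ∃ λ k → i' ≡ i + k * + 3 × j' ≡ j + k * + p
    translate (r , q , w , r<3 , i≡ , j≡ , l , u) (r' , q' , w' , r'<3 , i≡' , j≡' , l' , u') =
      q' - q , shifted {+ 3} {i} {i'} {+ r} i≡ (trans i≡' (cong (λ t → + t + q' * + 3) (sym r≡r')))
             , shifted {+ p} {j} {j'} {+ w} j≡ (trans j≡' (cong (λ t → + t + q' * + p) (sym w≡w')))
      where
      r≡r' : r ≡ r'
      r≡r' = window-unique z≤n r<3 z≤n r'<3
               (mod-trans (+ r) i (+ r') (mod-sym i (+ r) (mod-remainder 3 (+ r) q i≡))
                 (mod-trans i i' (+ r') i≡i' (mod-remainder 3 (+ r') q' i≡')))
      narrow : ∀ {w} → w N.< upper r → w N.< lower r N.+ p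
      narrow w<u = NP.<-≤-trans w<u (upper≤lower+p r r<3)
      w≡w' : w ≡ w'
      w≡w' = window-unique l (narrow u)
               (subst (λ t → lower t N.≤ w') (sym r≡r') l')
               (narrow (subst (λ t → w' N.< upper t) (sym r≡r') u'))
               (mod-trans (+ w) j (+ w') (mod-sym j (+ w) (mod-remainder p (+ w) q j≡))
                 (mod-trans j j' (+ w') j≡j' (mod-remainder p (+ w') q' j≡')))
      shifted : ∀ {n a b x} → a ≡ x + q * n → b ≡ x + q' * n → b ≡ a + (q' - q) * n
      shifted {n} {x = x} refl refl = regroup x q q' n
        where
        regroup : ∀ x q q' n → x + q' * n ≡ (x + q * n) + (q' - q) * n
        regroup = solve-∀

-- A column meeting rows among 0, 1, 2 but not all
-- three has one of six row sets, numbered cyclically as its type: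
--   0 : {2,0}   1 : {0}   2 : {0,1}   3 : {1}   4 : {1,2}   5 : {2}.
-- Row s is met exactly by the types 2s, 2s + 1, 2s + 2 (mod 6).
data Meets : ℕ → ℕ → Set where
  type0-row0 : Meets 0 0
  type0-row2 : Meets 0 2
  type1-row0 : Meets 1 0
  type2-row0 : Meets 2 0
  type2-row1 : Meets 2 1
  type3-row1 : Meets 3 1
  type4-row1 : Meets 4 1
  type4-row2 : Meets 4 2
  type5-row2 : Meets 5 2

meets-type<6 : ∀ {τ s} → Meets τ s → τ N.< 6
meets-type<6 type0-row0 = s≤s z≤n
meets-type<6 type0-row2 = s≤s z≤n
meets-type<6 type1-row0 = s≤s (s≤s z≤n)
meets-type<6 type2-row0 = s≤s (s≤s (s≤s z≤n))
meets-type<6 type2-row1 = s≤s (s≤s (s≤s z≤n))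
meets-type<6 type3-row1 = s≤s (s≤s (s≤s (s≤s z≤n)))
meets-type<6 type4-row1 = s≤s (s≤s (s≤s (s≤s (s≤s z≤n))))
meets-type<6 type4-row2 = s≤s (s≤s (s≤s (s≤s (s≤s z≤n))))
meets-type<6 type5-row2 = s≤s (s≤s (s≤s (s≤s (s≤s (s≤s z≤n)))))

-- The type of a set of rows, given by deciding membership of 0, 1, 2
-- (the empty and the full set get the dummy type 6, which meets no row).
classify : ∀ {A B C : Set} → Dec A → Dec B → Dec C → ℕ
classify (yes _) (no _)  (yes _) = 0
classify (yes _) (no _)  (no _)  = 1
classify (yes _) (yes _) (no _)  = 2
classify (no _)  (yes _) (no _)  = 3
classify (no _)  (yes _) (yes _) = 4
classify (no _)  (no _)  (yes _) = 5
classify (yes _) (yes _) (yes _) = 6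
classify (no _)  (no _)  (no _)  = 6

classify-meets : ∀ {P : ℕ → Set} (d₀ : Dec (P 0)) (d₁ : Dec (P 1)) (d₂ : Dec (P 2)) {s} →
                 Meets (classify d₀ d₁ d₂) s → P s
classify-meets (yes p₀) (no _)   (yes _)  type0-row0 = p₀
classify-meets (yes _)  (no _)   (yes p₂) type0-row2 = p₂
classify-meets (yes p₀) (no _)   (no _)   type1-row0 = p₀
classify-meets (yes p₀) (yes _)  (no _)   type2-row0 = p₀
classify-meets (yes _)  (yes p₁) (no _)   type2-row1 = p₁
classify-meets (no _)   (yes p₁) (no _)   type3-row1 = p₁
classify-meets (no _)   (yes p₁) (yes _)  type4-row1 = p₁
classify-meets (no _)   (yes _)  (yes p₂) type4-row2 = p₂
classify-meets (no _)   (no _)   (yes p₂) type5-row2 = p₂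
classify-meets (yes _)  (yes _)  (yes _)  ()
classify-meets (no _)   (no _)   (no _)   ()

meets-classify : ∀ {P : ℕ → Set} s → s N.< 3 → P s → ¬ (P 0 × P 1 × P 2) →
                 (d₀ : Dec (P 0)) (d₁ : Dec (P 1)) (d₂ : Dec (P 2)) → Meets (classify d₀ d₁ d₂) s
meets-classify 0 _ p₀ _   (no ¬p₀) _        _        = ⊥-elim (¬p₀ p₀)
meets-classify 0 _ _  _   (yes _)  (no _)   (yes _)  = type0-row0
meets-classify 0 _ _  _   (yes _)  (no _)   (no _)   = type1-row0
meets-classify 0 _ _  _   (yes _)  (yes _)  (no _)   = type2-row0
meets-classify 0 _ _  all (yes p₀) (yes p₁) (yes p₂) = ⊥-elim (all (p₀ , p₁ , p₂))
meets-classify 1 _ p₁ _   _        (no ¬p₁) _        = ⊥-elim (¬p₁ p₁)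
meets-classify 1 _ _  _   (yes _)  (yes _)  (no _)   = type2-row1
meets-classify 1 _ _  _   (no _)   (yes _)  (no _)   = type3-row1
meets-classify 1 _ _  _   (no _)   (yes _)  (yes _)  = type4-row1
meets-classify 1 _ _  all (yes p₀) (yes p₁) (yes p₂) = ⊥-elim (all (p₀ , p₁ , p₂))
meets-classify 2 _ p₂ _   _        _        (no ¬p₂) = ⊥-elim (¬p₂ p₂)
meets-classify 2 _ _  _   (yes _)  (no _)   (yes _)  = type0-row2
meets-classify 2 _ _  _   (no _)   (yes _)  (yes _)  = type4-row2
meets-classify 2 _ _  _   (no _)   (no _)   (yes _)  = type5-row2
meets-classify 2 _ _  all (yes p₀) (yes p₁) (yes p₂) = ⊥-elim (all (p₀ , p₁ , p₂))
meets-classify (suc (suc (suc _))) (s≤s (s≤s (s≤s ()))) _ _ _ _ _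

firstIndex : ℤ → List ℤ → ℕ
firstIndex x [] = 0
firstIndex x (y ∷ ys) with x Z.≟ y
... | yes _ = 0
... | no _ = suc (firstIndex x ys)

firstIndex-< : ∀ {x} xs → x ∈ xs → firstIndex x xs N.< length xs
firstIndex-< {x} (y ∷ ys) x∈ with x Z.≟ y
... | yes _ = s≤s z≤n
firstIndex-< {x} (y ∷ ys) (here x≡y) | no x≢y = ⊥-elim (x≢y x≡y)
firstIndex-< {x} (y ∷ ys) (there x∈) | no _ = s≤s (firstIndex-< ys x∈)

firstIndex-injective : ∀ {x x'} xs → x ∈ xs → x' ∈ xs → firstIndex x xs ≡ firstIndex x' xs → x ≡ x'
firstIndex-injective {x} {x'} (y ∷ ys) x∈ x'∈ eq with x Z.≟ y | x' Z.≟ y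
... | yes x≡y | yes x'≡y = trans x≡y (sym x'≡y)
firstIndex-injective (y ∷ ys) (here x≡y) _ _ | no x≢y | _ = ⊥-elim (x≢y x≡y)
firstIndex-injective (y ∷ ys) _ (here x'≡y) _ | _ | no x'≢y = ⊥-elim (x'≢y x'≡y)
firstIndex-injective (y ∷ ys) (there x∈) (there x'∈) eq | no _ | no _ =
  firstIndex-injective ys x∈ x'∈ (NP.suc-injective eq)

firstIndex-here : ∀ x xs → firstIndex x (x ∷ xs) ≡ 0
firstIndex-here x xs with x Z.≟ x
... | yes _ = refl
... | no x≢x = ⊥-elim (x≢x refl)

firstIndex-there : ∀ {x y} xs → x ≢ y → firstIndex x (y ∷ xs) ≡ suc (firstIndex x xs)
firstIndex-there {x} {y} xs x≢y with x Z.≟ y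
... | yes x≡y = ⊥-elim (x≢y x≡y)
... | no _ = refl

firstIndex-surjective : ∀ {xs} → Unique xs → ∀ {k} → k N.< length xs →
                        ∃ λ x → x ∈ xs × firstIndex x xs ≡ k
firstIndex-surjective {x ∷ xs} (_ ∷ _) {zero} _ = x , here refl , firstIndex-here x xs
firstIndex-surjective {x ∷ xs} (x∉xs ∷ unique) {suc k} k<len =
  let (y , y∈ , index) = firstIndex-surjective unique (N.s≤s⁻¹ k<len)
  in y , there y∈ , trans (firstIndex-there xs (λ y≡x → All.lookup x∉xs y∈ (sym y≡x))) (cong suc index)

module Construction (D : Diagram) (r₀ r₁ r₂ : ℤ)
       (rows : ∀ i → IsRow D i → i ≡ r₀ ⊎ i ≡ r₁ ⊎ i ≡ r₂)
       (no-three : NoColumnWithThree D) where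

  rowNumber : ℤ → ℕ
  rowNumber i with i Z.≟ r₀
  ... | yes _ = 0
  ... | no _ with i Z.≟ r₁
  ...   | yes _ = 1
  ...   | no _ = 2

  rowNumber<3 : ∀ i → rowNumber i N.< 3
  rowNumber<3 i with i Z.≟ r₀
  ... | yes _ = s≤s z≤n
  ... | no _ with i Z.≟ r₁
  ...   | yes _ = s≤s (s≤s z≤n)
  ...   | no _ = s≤s (s≤s (s≤s z≤n))

  rowOf : ℕ → ℤ
  rowOf 0 = r₀
  rowOf 1 = r₁
  rowOf _ = r₂

  rowOf-rowNumber : ∀ i → IsRow D i → rowOf (rowNumber i) ≡ i
  rowOf-rowNumber i row-i with i Z.≟ r₀
  ... | yes i≡r₀ = sym i≡r₀
  ... | no i≢r₀ with i Z.≟ r₁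
  ...   | yes i≡r₁ = sym i≡r₁
  ...   | no i≢r₁ with rows i row-i
  ...     | inj₁ i≡r₀ = ⊥-elim (i≢r₀ i≡r₀)
  ...     | inj₂ (inj₁ i≡r₁) = ⊥-elim (i≢r₁ i≡r₁)
  ...     | inj₂ (inj₂ i≡r₂) = sym i≡r₂

  rowNumber-injective : ∀ {i i'} → IsRow D i → IsRow D i' → rowNumber i ≡ rowNumber i' → i ≡ i'
  rowNumber-injective {i} {i'} row-i row-i' eq =
    trans (sym (rowOf-rowNumber i row-i)) (trans (cong rowOf eq) (rowOf-rowNumber i' row-i'))

  Has : ℕ → ℤ → Set
  Has s j = ∃ λ i → (i , j) ∈ D × rowNumber i ≡ s

  has? : ∀ s j → Dec (Has s j)
  has? s j = map′ found lost (any? (λ cell → (proj₂ cell Z.≟ j) ×-dec (rowNumber (proj₁ cell) N.≟ s)) D)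
    where
    found : Any (λ cell → proj₂ cell ≡ j × rowNumber (proj₁ cell) ≡ s) D → Has s j
    found a = let ((i , j') , m , j'≡j , e) = find a in i , subst (λ t → (i , t) ∈ D) j'≡j m , e
    lost : Has s j → Any (λ cell → proj₂ cell ≡ j × rowNumber (proj₁ cell) ≡ s) D
    lost (i , m , e) = lose m (refl , e)

  not-all-rows : ∀ j → ¬ (Has 0 j × Has 1 j × Has 2 j)
  not-all-rows j ((i₀ , m₀ , e₀) , (i₁ , m₁ , e₁) , (i₂ , m₂ , e₂)) =
    no-three i₀ i₁ i₂ j m₀ m₁ m₂ (distinct e₀ e₁ (λ ()) , distinct e₀ e₂ (λ ()) , distinct e₁ e₂ (λ ()))
    where
    distinct : ∀ {i i' s s'} → rowNumber i ≡ s → rowNumber i' ≡ s' → s ≢ s' → i ≢ i'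
    distinct e e' s≢s' refl = s≢s' (trans (sym e) e')

  typeOf : ℤ → ℕ
  typeOf j = classify (has? 0 j) (has? 1 j) (has? 2 j)

  cell-meets : ∀ {i j} → (i , j) ∈ D → Meets (typeOf j) (rowNumber i)
  cell-meets {i} {j} m =
    meets-classify {λ s → Has s j} (rowNumber i) (rowNumber<3 i) (i , m , refl) (not-all-rows j) (has? 0 j) (has? 1 j) (has? 2 j)

  meets-cell : ∀ {j s} → Meets (typeOf j) s → Has s j
  meets-cell {j} = classify-meets {λ s → Has s j} (has? 0 j) (has? 1 j) (has? 2 j)

  -- Block τ: the distinct columns of type τ, listed without repetition;
  -- they occupy the positions  start τ … start (τ + 1) - 1.  The list is
  -- kept abstract: only the three properties below are used, and unfolding
  -- it during type checking would be needlessly expensive.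
  abstract
    block : ℕ → List ℤ
    block τ = deduplicate Z._≟_ (filter (λ j → typeOf j N.≟ τ) (map proj₂ D))

    column∈block : ∀ {j} → IsCol D j → j ∈ block (typeOf j)
    column∈block {j} (i , m) =
      ∈P.∈-deduplicate⁺ Z._≟_ (∈P.∈-filter⁺ (λ j' → typeOf j' N.≟ typeOf j) (∈P.∈-map⁺ proj₂ m) refl)

    block-column : ∀ {j τ} → j ∈ block τ → IsCol D j × typeOf j ≡ τ
    block-column {j} {τ} j∈ =
      let (j∈columns , type≡) = ∈P.∈-filter⁻ (λ j' → typeOf j' N.≟ τ) {xs = map proj₂ D}
                                   (∈P.∈-deduplicate⁻ Z._≟_ _ j∈)
          ((i , j') , m , j≡j') = ∈P.∈-map⁻ proj₂ j∈columns
      in (i , subst (λ t → (i , t) ∈ D) (sym j≡j') m) , type≡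

    block-unique : ∀ τ → Unique (block τ)
    block-unique τ = deduplicate-! (filter (λ j → typeOf j N.≟ τ) (map proj₂ D))

  size : ℕ → ℕ
  size τ = length (block τ)

  start : ℕ → ℕ
  start zero = 0
  start (suc τ) = start τ N.+ size τ

  position : ℤ → ℕ
  position j = start (typeOf j) N.+ firstIndex j (block (typeOf j))

  position-of-type : ∀ {j τ} → typeOf j ≡ τ → position j ≡ start τ N.+ firstIndex j (block τ)
  position-of-type refl = refl

  start-mono : ∀ {τ τ'} → τ N.≤ τ' → start τ N.≤ start τ'
  start-mono {τ' = zero} z≤n = NP.≤-refl
  start-mono {τ' = suc τ'} τ≤1+τ' with NP.m≤n⇒m<n∨m≡n τ≤1+τ'
  ... | inj₁ τ<1+τ' = NP.≤-trans (start-mono (N.s≤s⁻¹ τ<1+τ')) (NP.m≤m+n (start τ') (size τ'))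
  ... | inj₂ refl = NP.≤-refl

  InBlock : ℕ → ℕ → Set
  InBlock τ x = start τ N.≤ x × x N.< start (suc τ)

  blocks-disjoint : ∀ {τ τ' x} → InBlock τ x → InBlock τ' x → τ ≡ τ'
  blocks-disjoint {τ} {τ'} (l , u) (l' , u') with NP.<-cmp τ τ'
  ... | tri< τ<τ' _ _ = ⊥-elim (NP.<⇒≱ u (NP.≤-trans (start-mono τ<τ') l'))
  ... | tri≈ _ τ≡τ' _ = τ≡τ'
  ... | tri> _ _ τ'<τ = ⊥-elim (NP.<⇒≱ u' (NP.≤-trans (start-mono τ'<τ) l))

  position-in-block : ∀ {j} → IsCol D j → InBlock (typeOf j) (position j)
  position-in-block {j} col =
    NP.m≤m+n _ _ , NP.+-monoʳ-< (start (typeOf j)) (firstIndex-< (block (typeOf j)) (column∈block col))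

  position-injective : ∀ {j j'} → IsCol D j → IsCol D j' → position j ≡ position j' → j ≡ j'
  position-injective {j} {j'} col col' eq =
    firstIndex-injective (block (typeOf j)) (column∈block col) j'∈ (NP.+-cancelˡ-≡ (start (typeOf j)) _ _ eq')
    where
    same-type : typeOf j' ≡ typeOf j
    same-type = blocks-disjoint (subst (InBlock (typeOf j')) (sym eq) (position-in-block col'))
                                (position-in-block col)
    j'∈ : j' ∈ block (typeOf j)
    j'∈ = subst (λ τ → j' ∈ block τ) same-type (column∈block col')
    eq' : start (typeOf j) N.+ firstIndex j (block (typeOf j)) ≡ start (typeOf j) N.+ firstIndex j' (block (typeOf j))
    eq' = trans eq (position-of-type same-type)

  block-enumerated : ∀ {τ x} → InBlock τ x → ∃ λ j → IsCol D j × typeOf j ≡ τ × position j ≡ x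
  block-enumerated {τ} {x} (l , u) =
    let (j , j∈ , index≡) = firstIndex-surjective (block-unique τ)
                               (subst (x N.∸ start τ N.<_) (NP.m+n∸m≡n (start τ) (size τ)) (NP.∸-monoˡ-< u l))
        (col , type≡) = block-column j∈
    in j , col , type≡ , trans (position-of-type type≡) (trans (cong (start τ N.+_) index≡) (NP.m+[n∸m]≡n l))

  -- The period: the number of distinct columns (at least 1).
  period : ℕ
  period = 1 N.⊔ start 6

  1≤period : 1 N.≤ period
  1≤period = NP.m≤m⊔n 1 (start 6)

  start≤period : ∀ {τ} → τ N.≤ 6 → start τ N.≤ period
  start≤period τ≤6 = NP.≤-trans (start-mono τ≤6) (NP.m≤n⊔m 1 (start 6))

  period-exact : 1 N.≤ start 6 → period ≡ start 6
  period-exact = NP.m≤n⇒m⊔n≡n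

  position<period : ∀ {j} → IsCol D j → position j N.< period
  position<period (i , m) = NP.<-≤-trans (proj₂ (position-in-block (i , m))) (start≤period (meets-type<6 (cell-meets m)))

  -- Row s occupies the positions of blocks 2s, 2s + 1, 2s + 2, the last
  -- block of row 2 (block 0) being read one period further on.
  lower : ℕ → ℕ
  lower 0 = start 0
  lower 1 = start 2
  lower _ = start 4

  upper : ℕ → ℕ
  upper 0 = start 3
  upper 1 = start 5
  upper _ = start 6 N.+ size 0

  -- The window of row 2 ends one period after block 0, hence within p of
  -- the start of any later block.
  wrap-bound : ∀ {τ} → 1 N.≤ τ → τ N.≤ 6 → start 6 N.+ size 0 N.≤ start τ N.+ period
  wrap-bound {τ} 1≤τ τ≤6 = begin
    start 6 N.+ size 0    ≤⟨ NP.+-monoʳ-≤ (start 6) (start-mono 1≤τ) ⟩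
    start 6 N.+ start τ   ≡⟨ NP.+-comm (start 6) (start τ) ⟩
    start τ N.+ start 6   ≤⟨ NP.+-monoʳ-≤ (start τ) (start≤period {6} NP.≤-refl) ⟩
    start τ N.+ period    ∎
    where open NP.≤-Reasoning hiding (start)

  lower-staircase : Staircase period lower
  lower-staircase = z≤n , start-mono {2} {4} (s≤s (s≤s z≤n)) , start≤period {4} (s≤s (s≤s (s≤s (s≤s z≤n))))

  upper-staircase : Staircase period upper
  upper-staircase = start-mono {3} {5} (s≤s (s≤s (s≤s z≤n)))
                  , NP.≤-trans (start-mono {5} {6} (s≤s (s≤s (s≤s (s≤s (s≤s z≤n)))))) (NP.m≤m+n (start 6) (size 0))
                  , wrap-bound {3} (s≤s z≤n) (s≤s (s≤s (s≤s z≤n)))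

  lower≤upper : ∀ r → r N.< 3 → lower r N.≤ upper r
  lower≤upper 0 _ = z≤n
  lower≤upper 1 _ = start-mono {2} {5} (s≤s (s≤s z≤n))
  lower≤upper 2 _ = NP.≤-trans (start-mono {4} {6} (s≤s (s≤s (s≤s (s≤s z≤n))))) (NP.m≤m+n (start 6) (size 0))
  lower≤upper (suc (suc (suc _))) (s≤s (s≤s (s≤s ())))

  upper≤lower+period : ∀ r → r N.< 3 → upper r N.≤ lower r N.+ period
  upper≤lower+period 0 _ = start≤period {3} (s≤s (s≤s (s≤s z≤n)))
  upper≤lower+period 1 _ = NP.≤-trans (start≤period {5} (s≤s (s≤s (s≤s (s≤s (s≤s z≤n))))))
                                      (NP.m≤n+m period (start 2))
  upper≤lower+period 2 _ = wrap-bound {4} (s≤s z≤n) (s≤s (s≤s (s≤s (s≤s z≤n))))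
  upper≤lower+period (suc (suc (suc _))) (s≤s (s≤s (s≤s ())))

  open BandShape period lower upper lower-staircase upper-staircase lower≤upper upper≤lower+period public

  Wraps : ℕ → ℕ → Set
  Wraps x w = w ≡ x ⊎ w ≡ x N.+ period

  wraps-mod : ∀ {x w} → Wraps x w → (+ w) ≡ (+ x) [mod period ]
  wraps-mod {x} (inj₁ refl) = mod-refl period (+ x)
  wraps-mod {x} (inj₂ refl) =
    mod-remainder period (+ x) (+ 1) (trans (ZP.pos-+ x period) (cong (λ t → + x + t) (sym (ZP.*-identityˡ (+ period)))))

  within : ∀ {τ₁ τ τ₂ x} → τ₁ N.≤ τ → τ N.< τ₂ → InBlock τ x → start τ₁ N.≤ x × x N.< start τ₂
  within τ₁≤τ τ<τ₂ (l , u) = NP.≤-trans (start-mono τ₁≤τ) l , NP.<-≤-trans u (start-mono τ<τ₂)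

  below-wrap : ∀ {x} → x N.< start 6 → x N.< start 6 N.+ size 0
  below-wrap x<s₆ = NP.<-≤-trans x<s₆ (NP.m≤m+n (start 6) (size 0))

  block-in-band : ∀ {τ s x} → Meets τ s → InBlock τ x → ∃ λ w → InBand s w × Wraps x w
  block-in-band type0-row0 b = _ , within {0} {0} {3} z≤n (s≤s z≤n) b , inj₁ refl
  block-in-band type1-row0 b = _ , within {0} {1} {3} z≤n (s≤s (s≤s z≤n)) b , inj₁ refl
  block-in-band type2-row0 b = _ , within {0} {2} {3} z≤n NP.≤-refl b , inj₁ refl
  block-in-band type2-row1 b = _ , within {2} {2} {5} NP.≤-refl (s≤s (s≤s (s≤s z≤n))) b , inj₁ refl
  block-in-band type3-row1 b = _ , within {2} {3} {5} (s≤s (s≤s z≤n)) (s≤s (s≤s (s≤s (s≤s z≤n)))) b , inj₁ refl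
  block-in-band type4-row1 b = _ , within {2} {4} {5} (s≤s (s≤s z≤n)) NP.≤-refl b , inj₁ refl
  block-in-band type4-row2 b =
    let (l , u) = within {4} {4} {6} NP.≤-refl (s≤s (s≤s (s≤s (s≤s (s≤s z≤n))))) b in _ , (l , below-wrap u) , inj₁ refl
  block-in-band type5-row2 b =
    let (l , u) = within {4} {5} {6} (s≤s (s≤s (s≤s (s≤s z≤n)))) NP.≤-refl b in _ , (l , below-wrap u) , inj₁ refl
  block-in-band {x = x} type0-row2 (_ , x<s₁) =
    x N.+ period , (l , u) , inj₂ refl
    where
    exact : period ≡ start 6
    exact = period-exact (NP.≤-trans (s≤s z≤n) (NP.≤-trans x<s₁ (start-mono {1} {6} (s≤s z≤n))))
    l : start 4 N.≤ x N.+ period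
    l = NP.≤-trans (start≤period {4} (s≤s (s≤s (s≤s (s≤s z≤n))))) (NP.m≤n+m period x)
    u : x N.+ period N.< start 6 N.+ size 0
    u = subst (λ t → x N.+ t N.< start 6 N.+ size 0) (sym exact)
          (subst (x N.+ start 6 N.<_) (NP.+-comm (size 0) (start 6)) (NP.+-monoˡ-< (start 6) x<s₁))

  band-in-blocks : ∀ {s w} → s N.< 3 → InBand s w →
                   ∃ λ τ → ∃ λ x → Meets τ s × InBlock τ x × Wraps x w
  band-in-blocks {0} {w} _ (_ , w<s₃) with w N.<? start 1
  ... | yes w<s₁ = 0 , w , type0-row0 , (z≤n , w<s₁) , inj₁ refl
  ... | no w≮s₁ with w N.<? start 2
  ...   | yes w<s₂ = 1 , w , type1-row0 , (NP.≮⇒≥ w≮s₁ , w<s₂) , inj₁ refl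
  ...   | no w≮s₂ = 2 , w , type2-row0 , (NP.≮⇒≥ w≮s₂ , w<s₃) , inj₁ refl
  band-in-blocks {1} {w} _ (s₂≤w , w<s₅) with w N.<? start 3
  ... | yes w<s₃ = 2 , w , type2-row1 , (s₂≤w , w<s₃) , inj₁ refl
  ... | no w≮s₃ with w N.<? start 4
  ...   | yes w<s₄ = 3 , w , type3-row1 , (NP.≮⇒≥ w≮s₃ , w<s₄) , inj₁ refl
  ...   | no w≮s₄ = 4 , w , type4-row1 , (NP.≮⇒≥ w≮s₄ , w<s₅) , inj₁ refl
  band-in-blocks {2} {w} _ (s₄≤w , w<u) with w N.<? start 5
  ... | yes w<s₅ = 4 , w , type4-row2 , (s₄≤w , w<s₅) , inj₁ refl
  ... | no w≮s₅ with w N.<? start 6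
  ...   | yes w<s₆ = 5 , w , type5-row2 , (NP.≮⇒≥ w≮s₅ , w<s₆) , inj₁ refl
  ...   | no w≮s₆ = 0 , x , type0-row2 , (z≤n , x<s₁) , inj₂ w≡
    where
    s₆≤w : start 6 N.≤ w
    s₆≤w = NP.≮⇒≥ w≮s₆
    x : ℕ
    x = w N.∸ start 6
    x<s₁ : x N.< start 1
    x<s₁ = subst (x N.<_) (NP.m+n∸m≡n (start 6) (size 0)) (NP.∸-monoˡ-< w<u s₆≤w)
    w≡ : w ≡ x N.+ period
    w≡ = trans (sym (NP.m∸n+n≡m s₆≤w))
               (cong (x N.+_) (sym (period-exact (NP.≤-trans (s≤s z≤n) (NP.≤-trans x<s₁ (start-mono {1} {6} (s≤s z≤n)))))))
  band-in-blocks {suc (suc (suc _))} (s≤s (s≤s (s≤s ()))) _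

  α : ℤ → ℤ
  α i = + rowNumber i

  β : ℤ → ℤ
  β j = + position j

  α-injective : ∀ i i' → IsRow D i → IsRow D i' → α i ≡ α i' [mod 3 ] → i ≡ i'
  α-injective i i' row-i row-i' eq =
    rowNumber-injective row-i row-i' (window-unique z≤n (rowNumber<3 i) z≤n (rowNumber<3 i') eq)

  β-injective : ∀ j j' → IsCol D j → IsCol D j' → β j ≡ β j' [mod period ] → j ≡ j'
  β-injective j j' col col' eq =
    position-injective col col' (window-unique z≤n (position<period col) z≤n (position<period col') eq)

  cells-injective : ∀ i j i' j' → (i , j) ∈ D → (i' , j') ∈ D →
                    α i ≡ α i' [mod 3 ] → β j ≡ β j' [mod period ] → (i , j) ≡ (i' , j')
  cells-injective i j i' j' m m' eqα eqβ =
    cong₂ _,_ (α-injective i i' (j , m) (j' , m') eqα) (β-injective j j' (i , m) (i' , m') eqβ)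

  into-image : ∀ i j → (i , j) ∈ D → InImage shape (α i) (β j)
  into-image i j m =
    let (w , band , wraps) = block-in-band (cell-meets m) (position-in-block (i , m))
    in α i + + 0 * + 3 , + w + + 0 * + period , in-shape (+ 0) (rowNumber<3 i) band
       , mod-remainder 3 (α i) (+ 0) refl
       , mod-trans (+ w + + 0 * + period) (+ w) (β j) (mod-remainder period (+ w) (+ 0) refl) (wraps-mod wraps)

  onto-image : ∀ r c → InImage shape r c →
               ∃ λ i → ∃ λ j → (i , j) ∈ D × α i ≡ r [mod 3 ] × β j ≡ c [mod period ]
  onto-image r c (i₀ , j₀ , in-E , i₀≡r , j₀≡c) =
    let (s , q , w , s<3 , i₀≡ , j₀≡ , band) = shape-cell in-E
        (τ , x , meets , in-block , wraps) = band-in-blocks s<3 band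
        (j , _ , type≡ , position≡) = block-enumerated in-block
        (i , m , row≡) = meets-cell (subst (λ t → Meets t s) (sym type≡) meets)
    in i , j , m
       , subst (λ t → (+ t) ≡ r [mod 3 ]) (sym row≡)
           (mod-trans (+ s) i₀ r (mod-sym i₀ (+ s) (mod-remainder 3 (+ s) q i₀≡)) i₀≡r)
       , subst (λ t → (+ t) ≡ c [mod period ]) (sym position≡)
           (mod-trans (+ x) (+ w) c (mod-sym (+ w) (+ x) (wraps-mod wraps))
             (mod-trans (+ w) j₀ c (mod-sym j₀ (+ w) (mod-remainder period (+ w) q j₀≡)) j₀≡c))

lemma7p18 : (D : Diagram) → AtMostThreeRows D → NoColumnWithThree D →
    Σ ℕ λ p → 1 ≤ p × Σ (CylSkew 3 p) λ E → Toric E ×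
    Σ (ℤ → ℤ) λ α → Σ (ℤ → ℤ) λ β → EquivVia D p E α β
lemma7p18 D (r₀ , r₁ , r₂ , rows) no-three =
  period , 1≤period , shape , toric , α , β ,
  α-injective , β-injective , into-image , cells-injective , onto-image
  where open Construction D r₀ r₁ r₂ rows no-three
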